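{- Let $\varepsilon>0$ be rational, let $F$ be a closed formula of formal arithmetic, and let $\pi$ be a proof strategy with initial capital $\varepsilon$. If the probability that $\pi$ achieves $F$ is greater than $\varepsilon$, then $F$ is true in the standard model of arithmetic.
   Context: Formal arithmetic means Peano arithmetic (PA); binary strings and numbers are coded in arithmetic in the usual way, and "true" means true in the standard model $\mathbb{N}$. A proof strategy with initial capital $\varepsilon$ is a finite tree describing a randomized proof process. The process maintains a set of accepted closed statements, initially empty, and a remaining capital, initially $\varepsilon$. At each node the strategy takes one of two kinds of steps. (i) An ordinary step: it accepts a formula that follows by the usual logical rules from the axioms of PA and the statements accepted so far. (ii) A randomized step: it must already have accepted, for some numeral $N$, some rational $\delta>0$ not exceeding the remaining capital, and some arithmetic formula $R(x)$ with one free string variable $x$, the closed statement "the number of strings $x$ of length $N$ such that $\lnot R(x)$ is at most $\delta 2^N$". It then tosses a fair coin $N$ times to obtain a uniformly random string $r$ of length $N$, accepts $R(r)$ as a new axiom, and the remaining capital decreases by $\delta$. The node branches into $2^N$ children, one for each outcome $r$, and the strategy specifies the subsequent steps separately for every outcome. The strategy achieves $F$ on a branch if $F$ is among the accepted statements on that branch. The probability of achieving $F$ is taken over the coin tosses. -}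

module Defs where

open import Data.Nat as ℕ using (ℕ; zero; suc; _^_)
open import Data.Nat.DivMod using (_/_)
open import Data.Integer using (∣_∣)
open import Data.Fin as Fin using (Fin; zero; suc)
open import Data.Fin.Properties using () renaming (_≟_ to _≟Fin_)
open import Data.Bool using (Bool; true; false; if_then_else_)
open import Data.Vec using (Vec; []; _∷_)
open import Data.List using (List; []; _∷_; foldr; allFin)
open import Data.List.Membership.Propositional using (_∈_)
open import Data.List.Membership.DecPropositional using () renaming (_∈?_ to member?)
open import Data.Empty using (⊥)
open import Data.Product using (_×_; _,_)
open import Relation.Nullary using (Dec; yes; no; ¬_)
open import Relation.Nullary.Decidable using (⌊_⌋)
open import Relation.Binary.PropositionalEquality using (_≡_; refl; cong; cong₂)
open import Data.Rational as ℚ using (ℚ; 0ℚ; 1ℚ; ½; ↥_; ↧ₙ_)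

-- Syntax of first-order arithmetic (language 0, S, +, ×, =),
-- scoped de Bruijn indices: Term n / Formula n have n free variables.

data Term (n : ℕ) : Set where
  var  : Fin n → Term n
  zer  : Term n
  succ : Term n → Term n
  _⊕_  : Term n → Term n → Term n
  _⊗_  : Term n → Term n → Term n

infixr 6 _⇒_
infix 7 _≐_

data Formula (n : ℕ) : Set where
  _≐_ : Term n → Term n → Formula n
  fls : Formula n
  _⇒_ : Formula n → Formula n → Formula n
  all : Formula (suc n) → Formula n

Sentence : Set
Sentence = Formula 0

neg : ∀ {n} → Formula n → Formula n
neg A = A ⇒ fls

tru : ∀ {n} → Formula n
tru = fls ⇒ fls

_∧'_ : ∀ {n} → Formula n → Formula n → Formula n
A ∧' B = neg (A ⇒ neg B)

_∨'_ : ∀ {n} → Formula n → Formula n → Formula n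
A ∨' B = neg A ⇒ B

ex : ∀ {n} → Formula (suc n) → Formula n
ex A = neg (all (neg A))

renT : ∀ {n m} → (Fin n → Fin m) → Term n → Term m
renT ρ (var i)  = var (ρ i)
renT ρ zer      = zer
renT ρ (succ t) = succ (renT ρ t)
renT ρ (s ⊕ t)  = renT ρ s ⊕ renT ρ t
renT ρ (s ⊗ t)  = renT ρ s ⊗ renT ρ t

extR : ∀ {n m} → (Fin n → Fin m) → Fin (suc n) → Fin (suc m)
extR ρ zero    = zero
extR ρ (suc i) = suc (ρ i)

renF : ∀ {n m} → (Fin n → Fin m) → Formula n → Formula m
renF ρ (s ≐ t) = renT ρ s ≐ renT ρ t
renF ρ fls     = fls
renF ρ (A ⇒ B) = renF ρ A ⇒ renF ρ B
renF ρ (all A) = all (renF (extR ρ) A)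

subT : ∀ {n m} → (Fin n → Term m) → Term n → Term m
subT σ (var i)  = σ i
subT σ zer      = zer
subT σ (succ t) = succ (subT σ t)
subT σ (s ⊕ t)  = subT σ s ⊕ subT σ t
subT σ (s ⊗ t)  = subT σ s ⊗ subT σ t

extS : ∀ {n m} → (Fin n → Term m) → Fin (suc n) → Term (suc m)
extS σ zero    = var zero
extS σ (suc i) = renT suc (σ i)

subF : ∀ {n m} → (Fin n → Term m) → Formula n → Formula m
subF σ (s ≐ t) = subT σ s ≐ subT σ t
subF σ fls     = fls
subF σ (A ⇒ B) = subF σ A ⇒ subF σ B
subF σ (all A) = all (subF (extS σ) A)

wkT : ∀ {n} → Term n → Term (suc n)
wkT = renT suc

wkF : ∀ {n} → Formula n → Formula (suc n)
wkF = renF suc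

wk0 : ∀ {n} → Sentence → Formula n
wk0 = renF (λ ())

_[_] : ∀ {n} → Formula (suc n) → Term n → Formula n
A [ t ] = subF (λ { zero → t ; (suc i) → var i }) A

substSucc : ∀ {n} → Formula (suc n) → Formula (suc n)
substSucc = subF (λ { zero → succ (var zero) ; (suc i) → var (suc i) })

num : ∀ {n} → ℕ → Term n
num zero    = zer
num (suc k) = succ (num k)

closeAll : ∀ {n} → Formula n → Sentence
closeAll {zero}  A = A
closeAll {suc n} A = closeAll (all A)

infix 3 _⊢_

data _⊢_ (Γ : List Sentence) : ∀ {n} → Formula n → Set where
  hyp   : ∀ {n} {A : Sentence} → A ∈ Γ → Γ ⊢ wk0 {n} A
  ax-K  : ∀ {n} {A B : Formula n} → Γ ⊢ A ⇒ B ⇒ A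
  ax-S  : ∀ {n} {A B C : Formula n} → Γ ⊢ (A ⇒ B ⇒ C) ⇒ (A ⇒ B) ⇒ A ⇒ C
  ax-DN : ∀ {n} {A : Formula n} → Γ ⊢ neg (neg A) ⇒ A
  mp    : ∀ {n} {A B : Formula n} → Γ ⊢ A ⇒ B → Γ ⊢ A → Γ ⊢ B
  gen   : ∀ {n} {A : Formula (suc n)} → Γ ⊢ A → Γ ⊢ all A
  ax-inst : ∀ {n} {A : Formula (suc n)} {t : Term n} → Γ ⊢ all A ⇒ A [ t ]
  ax-dist : ∀ {n} {A B : Formula (suc n)} → Γ ⊢ all (A ⇒ B) ⇒ all A ⇒ all B
  ax-vac  : ∀ {n} {A : Formula n} {B : Formula (suc n)} →
            Γ ⊢ all (wkF A ⇒ B) ⇒ A ⇒ all B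
  ax-refl  : ∀ {n} {t : Term n} → Γ ⊢ t ≐ t
  ax-subst : ∀ {n} {A : Formula (suc n)} {s t : Term n} →
             Γ ⊢ s ≐ t ⇒ A [ s ] ⇒ A [ t ]
  pa-zero  : ∀ {n} {t : Term n} → Γ ⊢ neg (succ t ≐ zer)
  pa-inj   : ∀ {n} {s t : Term n} → Γ ⊢ succ s ≐ succ t ⇒ s ≐ t
  pa-+0    : ∀ {n} {t : Term n} → Γ ⊢ (t ⊕ zer) ≐ t
  pa-+S    : ∀ {n} {s t : Term n} → Γ ⊢ (s ⊕ succ t) ≐ succ (s ⊕ t)
  pa-*0    : ∀ {n} {t : Term n} → Γ ⊢ (t ⊗ zer) ≐ zer
  pa-*S    : ∀ {n} {s t : Term n} → Γ ⊢ (s ⊗ succ t) ≐ ((s ⊗ t) ⊕ s)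
  pa-ind   : ∀ {n} {A : Formula (suc n)} →
             Γ ⊢ A [ zer ] ⇒ all (A ⇒ substSucc A) ⇒ all A

evalT : ∀ {n} → (Fin n → ℕ) → Term n → ℕ
evalT ρ (var i)  = ρ i
evalT ρ zer      = 0
evalT ρ (succ t) = suc (evalT ρ t)
evalT ρ (s ⊕ t)  = evalT ρ s ℕ.+ evalT ρ t
evalT ρ (s ⊗ t)  = evalT ρ s ℕ.* evalT ρ t

_∷ρ_ : ∀ {n} → ℕ → (Fin n → ℕ) → Fin (suc n) → ℕ
(x ∷ρ ρ) zero    = x
(x ∷ρ ρ) (suc i) = ρ i

Sat : ∀ {n} → (Fin n → ℕ) → Formula n → Set
Sat ρ (s ≐ t) = evalT ρ s ≡ evalT ρ t
Sat ρ fls     = ⊥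
Sat ρ (A ⇒ B) = Sat ρ A → Sat ρ B
Sat ρ (all A) = (x : ℕ) → Sat (x ∷ρ ρ) A

TrueInℕ : Sentence → Set
TrueInℕ F = Sat (λ ()) F

-- Coding of binary strings: b₁…b_N ↦ the number with binary expansion
-- 1b₁…b_N. Thus the codes of strings of length N are exactly the
-- numbers x with 2^N ≤ x < 2^(N+1).

codeAcc : ∀ {N} → ℕ → Vec Bool N → ℕ
codeAcc acc []          = acc
codeAcc acc (false ∷ r) = codeAcc (2 ℕ.* acc) r
codeAcc acc (true ∷ r)  = codeAcc (suc (2 ℕ.* acc)) r

code : ∀ {N} → Vec Bool N → ℕ
code = codeAcc 1

_≤'_ : ∀ {n} → Term n → Term n → Formula n
s ≤' t = ex ((wkT s ⊕ var zero) ≐ wkT t)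

_<'_ : ∀ {n} → Term n → Term n → Formula n
s <' t = succ s ≤' t

HasLength : ∀ {n} → ℕ → Term n → Formula n
HasLength N t = (num (2 ^ N) ≤' t) ∧' (t <' num (2 ^ suc N))

-- The arithmetized statement
--   "the number of strings x of length N with ¬R(x) is at most k":
-- for all x₀,…,x_k, if they are pairwise distinct codes of strings of
-- length N, then R(xᵢ) holds for some i.
bigAnd : ∀ {n} → List (Formula n) → Formula n
bigAnd = foldr _∧'_ tru

bigOr : ∀ {n} → List (Formula n) → Formula n
bigOr = foldr _∨'_ fls

AtMostFailing : ℕ → ℕ → Formula 1 → Sentence
AtMostFailing N k R = closeAll {suc k} body
  where
  vs : List (Fin (suc k))
  vs = allFin (suc k)
  lengths : Formula (suc k)
  lengths = bigAnd (Data.List.map (λ i → HasLength N (var i)) vs)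
  distinct : Formula (suc k)
  distinct = foldr (λ i acc → foldr (λ j acc′ →
               if ⌊ i ≟Fin j ⌋ then acc′ else (neg (var i ≐ var j) ∧' acc′))
               acc vs) tru vs
  someR : Formula (suc k)
  someR = bigOr (Data.List.map (λ i → subF (λ _ → var i) R) vs)
  body : Formula (suc k)
  body = (lengths ∧' distinct) ⇒ someR

-- "the number of strings x of length N with ¬R(x) is at most δ·2^N";
-- since the number is an integer this says it is at most ⌊δ·2^N⌋
-- (for δ > 0, δ = p/q in lowest terms, ⌊δ·2^N⌋ = (p·2^N) div q).
floorScaled : ℚ → ℕ → ℕ
floorScaled δ N = (∣ ↥ δ ∣ ℕ.* (2 ^ N)) / (↧ₙ δ)

CountStatement : ℕ → ℚ → Formula 1 → Sentence
CountStatement N δ R = AtMostFailing N (floorScaled δ N) R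

-- Proof strategies: finite trees. Index Γ = statements accepted so far,
-- c = remaining capital.

data Strategy : List Sentence → ℚ → Set where
  stop  : ∀ {Γ c} → Strategy Γ c
  step  : ∀ {Γ c} (φ : Sentence) → Γ ⊢ φ →
          Strategy (φ ∷ Γ) c → Strategy Γ c
  toss  : ∀ {Γ c} (N : ℕ) (δ : ℚ) (R : Formula 1) →
          0ℚ ℚ.< δ → δ ℚ.≤ c →
          CountStatement N δ R ∈ Γ →
          ((r : Vec Bool N) → Strategy (R [ num (code r) ] ∷ Γ) (c ℚ.- δ)) →
          Strategy Γ c

Expect : (N : ℕ) → (Vec Bool N → ℚ) → ℚ
Expect zero    f = f []
Expect (suc N) f = ½ ℚ.* (Expect N (λ r → f (false ∷ r)) ℚ.+ Expect N (λ r → f (true ∷ r)))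

_≟T_ : ∀ {n} → (s t : Term n) → Dec (s ≡ t)
var i ≟T var j with i ≟Fin j
... | yes refl = yes refl
... | no ne = no λ { refl → ne refl }
var _ ≟T zer = no λ ()
var _ ≟T succ _ = no λ ()
var _ ≟T (_ ⊕ _) = no λ ()
var _ ≟T (_ ⊗ _) = no λ ()
zer ≟T var _ = no λ ()
zer ≟T zer = yes refl
zer ≟T succ _ = no λ ()
zer ≟T (_ ⊕ _) = no λ ()
zer ≟T (_ ⊗ _) = no λ ()
succ _ ≟T var _ = no λ ()
succ _ ≟T zer = no λ ()
succ s ≟T succ t with s ≟T t
... | yes refl = yes refl
... | no ne = no λ { refl → ne refl }
succ _ ≟T (_ ⊕ _) = no λ ()
succ _ ≟T (_ ⊗ _) = no λ ()
(_ ⊕ _) ≟T var _ = no λ ()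
(_ ⊕ _) ≟T zer = no λ ()
(_ ⊕ _) ≟T succ _ = no λ ()
(s ⊕ t) ≟T (s′ ⊕ t′) with s ≟T s′ | t ≟T t′
... | yes refl | yes refl = yes refl
... | no ne | _ = no λ { refl → ne refl }
... | _ | no ne = no λ { refl → ne refl }
(_ ⊕ _) ≟T (_ ⊗ _) = no λ ()
(_ ⊗ _) ≟T var _ = no λ ()
(_ ⊗ _) ≟T zer = no λ ()
(_ ⊗ _) ≟T succ _ = no λ ()
(_ ⊗ _) ≟T (_ ⊕ _) = no λ ()
(s ⊗ t) ≟T (s′ ⊗ t′) with s ≟T s′ | t ≟T t′
... | yes refl | yes refl = yes refl
... | no ne | _ = no λ { refl → ne refl }
... | _ | no ne = no λ { refl → ne refl }

_≟F_ : ∀ {n} → (A B : Formula n) → Dec (A ≡ B)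
(s ≐ t) ≟F (s′ ≐ t′) with s ≟T s′ | t ≟T t′
... | yes refl | yes refl = yes refl
... | no ne | _ = no λ { refl → ne refl }
... | _ | no ne = no λ { refl → ne refl }
(_ ≐ _) ≟F fls = no λ ()
(_ ≐ _) ≟F (_ ⇒ _) = no λ ()
(_ ≐ _) ≟F all _ = no λ ()
fls ≟F (_ ≐ _) = no λ ()
fls ≟F fls = yes refl
fls ≟F (_ ⇒ _) = no λ ()
fls ≟F all _ = no λ ()
(_ ⇒ _) ≟F (_ ≐ _) = no λ ()
(_ ⇒ _) ≟F fls = no λ ()
(A ⇒ B) ≟F (A′ ⇒ B′) with A ≟F A′ | B ≟F B′
... | yes refl | yes refl = yes refl
... | no ne | _ = no λ { refl → ne refl }
... | _ | no ne = no λ { refl → ne refl }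
(_ ⇒ _) ≟F all _ = no λ ()
all _ ≟F (_ ≐ _) = no λ ()
all _ ≟F fls = no λ ()
all _ ≟F (_ ⇒ _) = no λ ()
all A ≟F all B with A ≟F B
... | yes refl = yes refl
... | no ne = no λ { refl → ne refl }

-- probability that the strategy achieves F (F is among the accepted
-- statements on the branch; accepted sets only grow, so it suffices to
-- look at the leaf)
ProbAchieve : Sentence → ∀ {Γ c} → Strategy Γ c → ℚ
ProbAchieve F {Γ} stop with member? _≟F_ F Γ
... | yes _ = 1ℚ
... | no  _ = 0ℚ
ProbAchieve F (step φ _ π) = ProbAchieve F π
ProbAchieve F (toss N δ R _ _ _ k) = Expect N (λ r → ProbAchieve F (k r))

module Submission where

-- The proof is an induction over the strategy tree with the
-- invariant "all accepted statements are true, so the probability of achieving F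
-- is at most the remaining capital":
--   * ordinary steps accept only true statements, by soundness of PA in ℕ;
--   * a randomized step that spends δ accepts the axiom R(r); it relies on the
--     accepted (hence true) statement that at most ⌊δ·2^N⌋ strings r fail R, so
--     the step adds a false axiom with probability at most δ, and every outcome
--     in which R(r) is true continues with capital c - δ.  Truth in ℕ is not decidable, so the
-- argument is classical where needed: formulas and rational inequalities are
-- stable under double negation, which is all the case distinctions require.

open import Defs
open import Data.Nat as ℕ using (ℕ; zero; suc; _^_; z≤n; s≤s)
import Data.Nat.Properties as ℕP
open import Data.Nat.DivMod using (m/n*n≤m)
import Data.Integer as ℤ
import Data.Integer.Properties as ℤP
open import Data.Fin using (Fin; zero; suc)
open import Data.Fin.Properties using () renaming (_≟_ to _≟Fin_)
open import Data.Bool using (Bool; true; false; if_then_else_)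
open import Data.Vec using (Vec; []; _∷_)
import Data.Vec.Properties as VecP
open import Data.List using (List; []; _∷_; foldr; allFin; map; length; _++_)
open import Data.List.Properties using (length-++; length-map)
open import Data.List.Membership.Propositional using (_∈_)
open import Data.List.Membership.Propositional.Properties using (∈-map⁻)
open import Data.List.Membership.DecPropositional using () renaming (_∈?_ to member?)
open import Data.List.Relation.Unary.Any using (here; there)
open import Data.List.Relation.Unary.All as All using (All; []; _∷_)
import Data.List.Relation.Unary.All.Properties as AllP
open import Data.List.Relation.Unary.Unique.Propositional using (Unique; []; _∷_)
import Data.List.Relation.Unary.Unique.Propositional.Properties as UniqueP
open import Data.Rational as ℚ
  using (ℚ; 0ℚ; 1ℚ; ½; mkℚ; _≤_; _<_; _+_; _*_; _-_; -_; ↥_; ↧ₙ_; toℚᵘ; positive)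
import Data.Rational.Properties as ℚP
import Data.Rational.Unnormalised as ℚᵘ
import Data.Rational.Unnormalised.Properties as ℚᵘP
open import Data.Rational.Solver using (module +-*-Solver)
open import Data.Empty using (⊥-elim)
open import Data.Product using (Σ; _×_; _,_; proj₁; proj₂)
open import Function.Base using (_∘_)
open import Function.Bundles using (_⇔_; mk⇔; Equivalence)
import Function.Properties.Equivalence as ⇔
open import Function.Related.TypeIsomorphisms using (→-cong-⇔)
open import Relation.Nullary using (¬_; Dec; yes; no)
open import Relation.Nullary.Decidable
  using (⌊_⌋; decidable-stable; isNo; ¬¬-excluded-middle)
open import Relation.Binary.PropositionalEquality
  using (_≡_; _≢_; refl; sym; trans; cong; cong₂; subst; subst₂; module ≡-Reasoning)

open Equivalence using (to; from)
open +-*-Solver using (solve; _:+_; _:*_; _:-_; _:=_)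

Env : ℕ → Set
Env n = Fin n → ℕ

∀-cong-⇔ : {P Q : ℕ → Set} → (∀ x → P x ⇔ Q x) → (∀ x → P x) ⇔ (∀ x → Q x)
∀-cong-⇔ P⇔Q = mk⇔ (λ p x → to (P⇔Q x) (p x)) (λ q x → from (P⇔Q x) (q x))

≡-cong-⇔ : {a a′ b b′ : ℕ} → a ≡ a′ → b ≡ b′ → (a ≡ b) ⇔ (a′ ≡ b′)
≡-cong-⇔ refl refl = ⇔.refl

evalT-ext : ∀ {n} {ρ η : Env n} → (∀ i → ρ i ≡ η i) → ∀ t → evalT ρ t ≡ evalT η t
evalT-ext e (var i)  = e i
evalT-ext e zer      = refl
evalT-ext e (succ t) = cong suc (evalT-ext e t)
evalT-ext e (s ⊕ t)  = cong₂ ℕ._+_ (evalT-ext e s) (evalT-ext e t)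
evalT-ext e (s ⊗ t)  = cong₂ ℕ._*_ (evalT-ext e s) (evalT-ext e t)

Sat-ext : ∀ {n} {ρ η : Env n} → (∀ i → ρ i ≡ η i) → ∀ A → Sat ρ A → Sat η A
Sat-ext e (s ≐ t) h = trans (sym (evalT-ext e s)) (trans h (evalT-ext e t))
Sat-ext e fls     h = h
Sat-ext e (A ⇒ B) h = Sat-ext e B ∘ h ∘ Sat-ext (sym ∘ e) A
Sat-ext {ρ = ρ} {η} e (all A) h x = Sat-ext ext A (h x)
  where
  ext : ∀ i → (x ∷ρ ρ) i ≡ (x ∷ρ η) i
  ext zero    = refl
  ext (suc i) = e i

evalT-renT : ∀ {n m} (ρ : Env m) (f : Fin n → Fin m) t →
             evalT ρ (renT f t) ≡ evalT (ρ ∘ f) t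
evalT-renT ρ f (var i)  = refl
evalT-renT ρ f zer      = refl
evalT-renT ρ f (succ t) = cong suc (evalT-renT ρ f t)
evalT-renT ρ f (s ⊕ t)  = cong₂ ℕ._+_ (evalT-renT ρ f s) (evalT-renT ρ f t)
evalT-renT ρ f (s ⊗ t)  = cong₂ ℕ._*_ (evalT-renT ρ f s) (evalT-renT ρ f t)

evalT-subT : ∀ {n m} (ρ : Env m) (σ : Fin n → Term m) t →
             evalT ρ (subT σ t) ≡ evalT (evalT ρ ∘ σ) t
evalT-subT ρ σ (var i)  = refl
evalT-subT ρ σ zer      = refl
evalT-subT ρ σ (succ t) = cong suc (evalT-subT ρ σ t)
evalT-subT ρ σ (s ⊕ t)  = cong₂ ℕ._+_ (evalT-subT ρ σ s) (evalT-subT ρ σ t)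
evalT-subT ρ σ (s ⊗ t)  = cong₂ ℕ._*_ (evalT-subT ρ σ s) (evalT-subT ρ σ t)

evalT-num : ∀ {n} (ρ : Env n) k → evalT ρ (num k) ≡ k
evalT-num ρ zero    = refl
evalT-num ρ (suc k) = cong suc (evalT-num ρ k)

-- Semantic renaming lemma: renF f A holds at ρ iff A holds at ρ ∘ f
-- (up to pointwise equality, so that it passes under binders).
Sat-renF : ∀ {n m} (A : Formula n) (ρ : Env m) (f : Fin n → Fin m) (η : Env n) →
           (∀ i → η i ≡ ρ (f i)) → Sat ρ (renF f A) ⇔ Sat η A
Sat-renF (s ≐ t) ρ f η e = ≡-cong-⇔ (term s) (term t)
  where
  term : ∀ u → evalT ρ (renT f u) ≡ evalT η u
  term u = trans (evalT-renT ρ f u) (evalT-ext (sym ∘ e) u)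
Sat-renF fls     ρ f η e = ⇔.refl
Sat-renF (A ⇒ B) ρ f η e = →-cong-⇔ (Sat-renF A ρ f η e) (Sat-renF B ρ f η e)
Sat-renF (all A) ρ f η e = ∀-cong-⇔ λ x → Sat-renF A (x ∷ρ ρ) (extR f) (x ∷ρ η) (ext x)
  where
  ext : ∀ x i → (x ∷ρ η) i ≡ (x ∷ρ ρ) (extR f i)
  ext x zero    = refl
  ext x (suc i) = e i

Sat-subF : ∀ {n m} (A : Formula n) (ρ : Env m) (σ : Fin n → Term m) (η : Env n) →
           (∀ i → η i ≡ evalT ρ (σ i)) → Sat ρ (subF σ A) ⇔ Sat η A
Sat-subF (s ≐ t) ρ σ η e = ≡-cong-⇔ (term s) (term t)
  where
  term : ∀ u → evalT ρ (subT σ u) ≡ evalT η u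
  term u = trans (evalT-subT ρ σ u) (evalT-ext (sym ∘ e) u)
Sat-subF fls     ρ σ η e = ⇔.refl
Sat-subF (A ⇒ B) ρ σ η e = →-cong-⇔ (Sat-subF A ρ σ η e) (Sat-subF B ρ σ η e)
Sat-subF (all A) ρ σ η e = ∀-cong-⇔ λ x → Sat-subF A (x ∷ρ ρ) (extS σ) (x ∷ρ η) (ext x)
  where
  ext : ∀ x i → (x ∷ρ η) i ≡ evalT (x ∷ρ ρ) (extS σ i)
  ext x zero    = refl
  ext x (suc i) = trans (e i) (sym (evalT-renT (x ∷ρ ρ) suc (σ i)))

Sat-wk0 : ∀ {n} (A : Sentence) (ρ : Env n) → Sat ρ (wk0 A) ⇔ TrueInℕ A
Sat-wk0 A ρ = Sat-renF A ρ (λ ()) (λ ()) (λ ())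

Sat-wkF : ∀ {n} (A : Formula n) x (ρ : Env n) → Sat (x ∷ρ ρ) (wkF A) ⇔ Sat ρ A
Sat-wkF A x ρ = Sat-renF A (x ∷ρ ρ) suc ρ (λ _ → refl)

Sat-[] : ∀ {n} (A : Formula (suc n)) t (ρ : Env n) → Sat ρ (A [ t ]) ⇔ Sat (evalT ρ t ∷ρ ρ) A
Sat-[] A t ρ = Sat-subF A ρ _ _ λ { zero → refl ; (suc i) → refl }

Sat-substSucc : ∀ {n} (A : Formula (suc n)) x (ρ : Env n) →
                Sat (x ∷ρ ρ) (substSucc A) ⇔ Sat (suc x ∷ρ ρ) A
Sat-substSucc A x ρ = Sat-subF A (x ∷ρ ρ) _ _ λ { zero → refl ; (suc i) → refl }

-- Truth in ℕ is classical: every formula is stable under double negation.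
-- This validates the axiom ¬¬A → A and lets us argue by contradiction.
Sat-stable : ∀ {n} (ρ : Env n) A → ¬ ¬ Sat ρ A → Sat ρ A
Sat-stable ρ (s ≐ t) = decidable-stable (evalT ρ s ℕP.≟ evalT ρ t)
Sat-stable ρ fls     ¬¬⊥ = ¬¬⊥ (λ z → z)
Sat-stable ρ (A ⇒ B) ¬¬AB a = Sat-stable ρ B λ ¬b → ¬¬AB λ f → ¬b (f a)
Sat-stable ρ (all A) ¬¬∀A x = Sat-stable (x ∷ρ ρ) A λ ¬a → ¬¬∀A λ f → ¬a (f x)

AllTrue : List Sentence → Set
AllTrue Γ = ∀ {A} → A ∈ Γ → TrueInℕ A

sound : ∀ {Γ n} {A : Formula n} → Γ ⊢ A → AllTrue Γ → ∀ ρ → Sat ρ A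
sound (hyp {A = A} A∈Γ)   T ρ = from (Sat-wk0 A ρ) (T A∈Γ)
sound ax-K                T ρ = λ a _ → a
sound ax-S                T ρ = λ f g a → f a (g a)
sound (ax-DN {A = A})     T ρ = Sat-stable ρ A
sound (mp d e)            T ρ = sound d T ρ (sound e T ρ)
sound (gen d)             T ρ = λ x → sound d T (x ∷ρ ρ)
sound (ax-inst {A = A} {t}) T ρ = λ ∀A → from (Sat-[] A t ρ) (∀A (evalT ρ t))
sound ax-dist             T ρ = λ h g x → h x (g x)
sound (ax-vac {A = A})    T ρ = λ h a x → h x (from (Sat-wkF A x ρ) a)
sound ax-refl             T ρ = refl
sound (ax-subst {A = A} {s} {t}) T ρ = λ s≡t As →
  from (Sat-[] A t ρ) (subst (λ v → Sat (v ∷ρ ρ) A) s≡t (to (Sat-[] A s ρ) As))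
sound pa-zero             T ρ = λ ()
sound pa-inj              T ρ = ℕP.suc-injective
sound (pa-+0 {t = t})     T ρ = ℕP.+-identityʳ (evalT ρ t)
sound (pa-+S {s = s} {t}) T ρ = ℕP.+-suc (evalT ρ s) (evalT ρ t)
sound (pa-*0 {t = t})     T ρ = ℕP.*-zeroʳ (evalT ρ t)
sound (pa-*S {s = s} {t}) T ρ =
  trans (ℕP.*-suc (evalT ρ s) (evalT ρ t)) (ℕP.+-comm (evalT ρ s) _)
sound (pa-ind {A = A})    T ρ = induction
  where
  induction : Sat ρ (A [ zer ]) → Sat ρ (all (A ⇒ substSucc A)) → ∀ x → Sat (x ∷ρ ρ) A
  induction base next zero    = to (Sat-[] A zer ρ) base
  induction base next (suc x) = to (Sat-substSucc A x ρ) (next x (induction base next x))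

double-shift : ∀ a x → 2 ℕ.* a ℕ.* x ≡ a ℕ.* (2 ℕ.* x)
double-shift a x = trans (cong (ℕ._* x) (ℕP.*-comm 2 a)) (ℕP.*-assoc a 2 x)

double-shift-suc : ∀ a x → suc (suc (2 ℕ.* a)) ℕ.* x ≡ suc a ℕ.* (2 ℕ.* x)
double-shift-suc a x = trans (cong (ℕ._* x) (sym (ℕP.*-suc 2 a))) (double-shift (suc a) x)

-- Reading off a string from its code (with any accumulator a): equal codes come
-- from equal accumulators and equal strings, because the last bit is the parity.
codeAcc-injective : ∀ {N} a a′ (r r′ : Vec Bool N) → codeAcc a r ≡ codeAcc a′ r′ → a ≡ a′ × r ≡ r′
codeAcc-injective a a′ [] [] e = e , refl
codeAcc-injective a a′ (false ∷ r) (false ∷ r′) e with codeAcc-injective _ _ r r′ e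
... | 2a≡2a′ , refl = ℕP.*-cancelˡ-≡ a a′ 2 2a≡2a′ , refl
codeAcc-injective a a′ (false ∷ r) (true ∷ r′) e =
  ⊥-elim (ℕP.even≢odd a a′ (proj₁ (codeAcc-injective _ _ r r′ e)))
codeAcc-injective a a′ (true ∷ r) (false ∷ r′) e =
  ⊥-elim (ℕP.even≢odd a′ a (sym (proj₁ (codeAcc-injective _ _ r r′ e))))
codeAcc-injective a a′ (true ∷ r) (true ∷ r′) e with codeAcc-injective _ _ r r′ e
... | 2a+1≡2a′+1 , refl = ℕP.*-cancelˡ-≡ a a′ 2 (ℕP.suc-injective 2a+1≡2a′+1) , refl

code-injective : ∀ {N} {r r′ : Vec Bool N} → code r ≡ code r′ → r ≡ r′
code-injective {r = r} {r′} = proj₂ ∘ codeAcc-injective 1 1 r r′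

codeAcc-lower : ∀ {N} a (r : Vec Bool N) → a ℕ.* 2 ^ N ℕ.≤ codeAcc a r
codeAcc-lower a [] = ℕP.≤-reflexive (ℕP.*-identityʳ a)
codeAcc-lower {suc N} a (false ∷ r) = begin
  a ℕ.* (2 ℕ.* 2 ^ N)   ≡⟨ sym (double-shift a (2 ^ N)) ⟩
  2 ℕ.* a ℕ.* 2 ^ N     ≤⟨ codeAcc-lower (2 ℕ.* a) r ⟩
  codeAcc (2 ℕ.* a) r   ∎
  where open ℕP.≤-Reasoning
codeAcc-lower {suc N} a (true ∷ r) = begin
  a ℕ.* (2 ℕ.* 2 ^ N)       ≡⟨ sym (double-shift a (2 ^ N)) ⟩
  2 ℕ.* a ℕ.* 2 ^ N         ≤⟨ ℕP.m≤n+m (2 ℕ.* a ℕ.* 2 ^ N) (2 ^ N) ⟩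
  suc (2 ℕ.* a) ℕ.* 2 ^ N   ≤⟨ codeAcc-lower (suc (2 ℕ.* a)) r ⟩
  codeAcc (suc (2 ℕ.* a)) r ∎
  where open ℕP.≤-Reasoning

codeAcc-upper : ∀ {N} a (r : Vec Bool N) → codeAcc a r ℕ.< suc a ℕ.* 2 ^ N
codeAcc-upper a [] = ℕP.≤-reflexive (sym (ℕP.*-identityʳ (suc a)))
codeAcc-upper {suc N} a (false ∷ r) = begin-strict
  codeAcc (2 ℕ.* a) r             <⟨ codeAcc-upper (2 ℕ.* a) r ⟩
  suc (2 ℕ.* a) ℕ.* 2 ^ N         ≤⟨ ℕP.*-monoˡ-≤ (2 ^ N) (ℕP.n≤1+n (suc (2 ℕ.* a))) ⟩
  suc (suc (2 ℕ.* a)) ℕ.* 2 ^ N   ≡⟨ double-shift-suc a (2 ^ N) ⟩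
  suc a ℕ.* (2 ℕ.* 2 ^ N)         ∎
  where open ℕP.≤-Reasoning
codeAcc-upper {suc N} a (true ∷ r) = begin-strict
  codeAcc (suc (2 ℕ.* a)) r       <⟨ codeAcc-upper (suc (2 ℕ.* a)) r ⟩
  suc (suc (2 ℕ.* a)) ℕ.* 2 ^ N   ≡⟨ double-shift-suc a (2 ^ N) ⟩
  suc a ℕ.* (2 ℕ.* 2 ^ N)         ∎
  where open ℕP.≤-Reasoning

code-lower : ∀ {N} (r : Vec Bool N) → 2 ^ N ℕ.≤ code r
code-lower {N} r = subst (ℕ._≤ code r) (ℕP.*-identityˡ (2 ^ N)) (codeAcc-lower 1 r)

code-upper : ∀ {N} (r : Vec Bool N) → code r ℕ.< 2 ^ suc N
code-upper r = codeAcc-upper 1 r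

Sat-∧' : ∀ {n} {ρ : Env n} A B → Sat ρ A → Sat ρ B → Sat ρ (A ∧' B)
Sat-∧' A B a b = λ f → f a b

Sat-bigAnd : ∀ {n} {ρ : Env n} (As : List (Formula n)) → All (Sat ρ) As → Sat ρ (bigAnd As)
Sat-bigAnd []       []       = λ z → z
Sat-bigAnd (A ∷ As) (a ∷ as) = Sat-∧' A (bigAnd As) a (Sat-bigAnd As as)

Sat-bigOr : ∀ {n} {ρ : Env n} (As : List (Formula n)) →
            Sat ρ (bigOr As) → ¬ All (¬_ ∘ Sat ρ) As
Sat-bigOr []       none  []         = none
Sat-bigOr (A ∷ As) A∨As (¬a ∷ ¬as) = Sat-bigOr As (A∨As ¬a) ¬as

Sat-≤' : ∀ {n} (ρ : Env n) s t → evalT ρ s ℕ.≤ evalT ρ t → Sat ρ (s ≤' t)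
Sat-≤' ρ s t s≤t noWitness = noWitness d (begin
  evalT (d ∷ρ ρ) (wkT s) ℕ.+ d  ≡⟨ cong (ℕ._+ d) (evalT-renT (d ∷ρ ρ) suc s) ⟩
  evalT ρ s ℕ.+ d               ≡⟨ ℕP.m+[n∸m]≡n s≤t ⟩
  evalT ρ t                     ≡⟨ sym (evalT-renT (d ∷ρ ρ) suc t) ⟩
  evalT (d ∷ρ ρ) (wkT t)        ∎)
  where
  open ≡-Reasoning
  d = evalT ρ t ℕ.∸ evalT ρ s

Sat-HasLength : ∀ {n N} (ρ : Env n) t (r : Vec Bool N) → evalT ρ t ≡ code r →
                Sat ρ (HasLength N t)
Sat-HasLength {N = N} ρ t r t≡r = Sat-∧' (num (2 ^ N) ≤' t) (t <' num (2 ^ suc N))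
  (Sat-≤' ρ (num (2 ^ N)) t (subst₂ ℕ._≤_ (sym (evalT-num ρ (2 ^ N))) (sym t≡r) (code-lower r)))
  (Sat-≤' ρ (succ t) (num (2 ^ suc N))
    (subst₂ ℕ._≤_ (cong suc (sym t≡r)) (sym (evalT-num ρ (2 ^ suc N))) (code-upper r)))

differentFrom : ∀ {m} → Fin m → List (Fin m) → Formula m → Formula m
differentFrom i js acc =
  foldr (λ j acc′ → if ⌊ i ≟Fin j ⌋ then acc′ else (neg (var i ≐ var j) ∧' acc′)) acc js

Sat-differentFrom : ∀ {m} (ρ : Env m) i js acc → (∀ j → i ≢ j → ρ i ≢ ρ j) →
                    Sat ρ acc → Sat ρ (differentFrom i js acc)
Sat-differentFrom ρ i []       acc i≢ a = a
Sat-differentFrom ρ i (j ∷ js) acc i≢ a with i ≟Fin j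
... | yes _   = Sat-differentFrom ρ i js acc i≢ a
... | no  i≢j = Sat-∧' (neg (var i ≐ var j)) (differentFrom i js acc) (i≢ j i≢j) (Sat-differentFrom ρ i js acc i≢ a)

Sat-pairwiseDifferent : ∀ {m} (ρ : Env m) is js → (∀ {i j} → ρ i ≡ ρ j → i ≡ j) →
                        Sat ρ (foldr (λ i acc → differentFrom i js acc) tru is)
Sat-pairwiseDifferent ρ []       js inj = λ z → z
Sat-pairwiseDifferent ρ (i ∷ is) js inj =
  Sat-differentFrom ρ i js _ (λ j i≢j → i≢j ∘ inj) (Sat-pairwiseDifferent ρ is js inj)

closeAll-elim : ∀ {n} (A : Formula n) → TrueInℕ (closeAll A) → ∀ ρ → Sat ρ A
closeAll-elim {zero}  A T ρ = Sat-ext (λ ()) A T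
closeAll-elim {suc n} A T ρ = Sat-ext split A (closeAll-elim (all A) T (ρ ∘ suc) (ρ zero))
  where
  split : ∀ i → (ρ zero ∷ρ (ρ ∘ suc)) i ≡ ρ i
  split zero    = refl
  split (suc i) = refl

AtMostFailing-true : ∀ N K R → TrueInℕ (AtMostFailing N K R) →
                     (g : Fin (suc K) → Vec Bool N) → (∀ {i j} → g i ≡ g j → i ≡ j) →
                     ¬ (∀ i → ¬ TrueInℕ (R [ num (code (g i)) ]))
AtMostFailing-true N K R T g g-inj R-fails =
  Sat-bigOr (map R-at vs) (body (Sat-∧' lengthsF distinctF lengths distinct))
            (AllP.map⁺ (All.universal R-fails-at vs))
  where
  vs : List (Fin (suc K))
  vs = allFin (suc K)
  ρ : Env (suc K)
  ρ = code ∘ g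
  R-at : Fin (suc K) → Formula (suc K)
  R-at i = subF (λ _ → var i) R
  lengthsF distinctF : Formula (suc K)
  lengthsF  = bigAnd (map (λ i → HasLength N (var i)) vs)
  distinctF = foldr (λ i acc → differentFrom i vs acc) tru vs
  body : Sat ρ ((lengthsF ∧' distinctF) ⇒ bigOr (map R-at vs))
  body = closeAll-elim _ T ρ
  lengths : Sat ρ lengthsF
  lengths = Sat-bigAnd _ (AllP.map⁺ (All.universal (λ i → Sat-HasLength ρ (var i) (g i) refl) vs))
  distinct : Sat ρ distinctF
  distinct = Sat-pairwiseDifferent ρ vs vs (g-inj ∘ code-injective)
  R-fails-at : ∀ i → ¬ Sat ρ (R-at i)
  R-fails-at i Ri = R-fails i (from (Sat-subF R (λ ()) _ (λ _ → ρ i) λ { zero → sym (evalT-num _ (ρ i)) })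
                                    (to (Sat-subF R ρ (λ _ → var i) (λ _ → ρ i) (λ _ → refl)) Ri))

failures : ∀ N → (Vec Bool N → Bool) → List (Vec Bool N)
failures zero    b with b []
... | true  = [] ∷ []
... | false = []
failures (suc N) b = map (false ∷_) (failures N (b ∘ (false ∷_)))
                  ++ map (true ∷_)  (failures N (b ∘ (true ∷_)))

failures-flagged : ∀ N b → All (λ r → b r ≡ true) (failures N b)
failures-flagged zero b with b [] in flag
... | true  = flag ∷ []
... | false = []
failures-flagged (suc N) b =
  AllP.++⁺ (AllP.map⁺ (failures-flagged N _)) (AllP.map⁺ (failures-flagged N _))

failures-unique : ∀ N b → Unique (failures N b)
failures-unique zero b with b []
... | true  = [] ∷ []
... | false = []
failures-unique (suc N) b = UniqueP.++⁺
  (UniqueP.map⁺ VecP.∷-injectiveʳ (failures-unique N _))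
  (UniqueP.map⁺ VecP.∷-injectiveʳ (failures-unique N _))
  different-heads
  where
  different-heads : ∀ {v} → ¬ (v ∈ map (false ∷_) _ × v ∈ map (true ∷_) _)
  different-heads (v∈₀ , v∈₁) with ∈-map⁻ (false ∷_) v∈₀ | ∈-map⁻ (true ∷_) v∈₁
  ... | _ , _ , refl | _ , _ , ()

unique-injection : {A : Set} (xs : List A) → Unique xs → (m : ℕ) → m ℕ.≤ length xs →
                   Σ (Fin m → A) λ g → (∀ {i j} → g i ≡ g j → i ≡ j) × (∀ i → g i ∈ xs)
unique-injection xs       u        zero    _         = (λ ()) , (λ { {()} }) , (λ ())
unique-injection (x ∷ xs) (x∉ ∷ u) (suc m) (s≤s m≤) with unique-injection xs u m m≤
... | g , g-inj , g∈ = g′ , g′-inj , g′∈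
  where
  g′ : Fin (suc m) → _
  g′ zero    = x
  g′ (suc i) = g i
  g′-inj : ∀ {i j} → g′ i ≡ g′ j → i ≡ j
  g′-inj {zero}  {zero}  _ = refl
  g′-inj {zero}  {suc j} e = ⊥-elim (All.lookup x∉ (g∈ j) e)
  g′-inj {suc i} {zero}  e = ⊥-elim (All.lookup x∉ (g∈ i) (sym e))
  g′-inj {suc i} {suc j} e = cong suc (g-inj e)
  g′∈ : ∀ i → g′ i ∈ (x ∷ xs)
  g′∈ zero    = here refl
  g′∈ (suc i) = there (g∈ i)

failures-bound : ∀ N K R → TrueInℕ (AtMostFailing N K R) → (b : Vec Bool N → Bool) →
                 (∀ r → b r ≡ true → ¬ TrueInℕ (R [ num (code r) ])) →
                 length (failures N b) ℕ.≤ K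
failures-bound N K R T b flagged⇒fails with length (failures N b) ℕP.≤? K
... | yes ≤K = ≤K
... | no  ≰K with unique-injection (failures N b) (failures-unique N b) (suc K) (ℕP.≰⇒> ≰K)
...   | g , g-inj , g∈ = ⊥-elim (AtMostFailing-true N K R T g g-inj
          λ i → flagged⇒fails (g i) (All.lookup (failures-flagged N b) (g∈ i)))

ι : ℕ → ℚ
ι zero    = 0ℚ
ι (suc n) = 1ℚ + ι n

ι-+ : ∀ m n → ι (m ℕ.+ n) ≡ ι m + ι n
ι-+ zero    n = sym (ℚP.+-identityˡ (ι n))
ι-+ (suc m) n = trans (cong (1ℚ +_) (ι-+ m n)) (sym (ℚP.+-assoc 1ℚ (ι m) (ι n)))

ι-* : ∀ m n → ι (m ℕ.* n) ≡ ι m * ι n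
ι-* zero    n = sym (ℚP.*-zeroˡ (ι n))
ι-* (suc m) n = begin
  ι (n ℕ.+ m ℕ.* n)     ≡⟨ ι-+ n (m ℕ.* n) ⟩
  ι n + ι (m ℕ.* n)     ≡⟨ cong₂ _+_ (sym (ℚP.*-identityˡ (ι n))) (ι-* m n) ⟩
  1ℚ * ι n + ι m * ι n  ≡⟨ sym (ℚP.*-distribʳ-+ (ι n) 1ℚ (ι m)) ⟩
  (1ℚ + ι m) * ι n      ∎
  where open ≡-Reasoning

ι-double : ∀ n → ι (2 ℕ.* n) ≡ ι n + ι n
ι-double n = trans (ι-+ n (n ℕ.+ 0)) (cong (λ k → ι n + ι k) (ℕP.+-identityʳ n))

ι-nonneg : ∀ n → 0ℚ ≤ ι n
ι-nonneg zero    = ℚP.≤-refl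
ι-nonneg (suc n) = ℚP.+-mono-≤ (ℚP.<⇒≤ (ℚP.positive⁻¹ 1ℚ)) (ι-nonneg n)

ι-positive : ∀ {n} → 0 ℕ.< n → 0ℚ < ι n
ι-positive {suc n} _ = ℚP.+-mono-<-≤ (ℚP.positive⁻¹ 1ℚ) (ι-nonneg n)

ι-mono : ∀ {m n} → m ℕ.≤ n → ι m ≤ ι n
ι-mono {n = n} z≤n = ι-nonneg n
ι-mono (s≤s m≤n)   = ℚP.+-monoʳ-≤ 1ℚ (ι-mono m≤n)

ι-toℚᵘ : ∀ n → toℚᵘ (ι n) ℚᵘ.≃ ℚᵘ.mkℚᵘ (ℤ.+ n) 0
ι-toℚᵘ zero    = ℚᵘP.≃-refl
ι-toℚᵘ (suc n) = ℚᵘP.≃-trans (ℚP.toℚᵘ-homo-+ 1ℚ (ι n))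
  (ℚᵘP.≃-trans (ℚᵘP.+-congʳ (toℚᵘ 1ℚ) (ι-toℚᵘ n))
    (ℚᵘ.*≡* (cong (ℤ._* ℤ.+ 1) (cong (ℤ._+_ (ℤ.+ 1)) (ℤP.*-identityʳ (ℤ.+ n))))))

numerator-product : (δ : ℚ) → 0ℚ < δ → δ * ι (↧ₙ δ) ≡ ι ℤ.∣ ↥ δ ∣
numerator-product δ@(mkℚ (ℤ.+ p) dm _) _ = ℚP.toℚᵘ-injective
  (ℚᵘP.≃-trans (ℚP.toℚᵘ-homo-* δ (ι (suc dm)))
    (ℚᵘP.≃-trans (ℚᵘP.*-congˡ {toℚᵘ δ} (ι-toℚᵘ (suc dm)))
      (ℚᵘP.≃-trans
        (ℚᵘ.*≡* (trans (ℤP.*-identityʳ _)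
                  (cong (λ k → ℤ.+ p ℤ.* ℤ.+ suc k) (sym (ℕP.*-identityʳ dm)))))
        (ℚᵘP.≃-sym (ι-toℚᵘ p)))))
numerator-product (mkℚ ℤ.-[1+ _ ] _ _) (ℚ.*<* ())

floorScaled-bound : ∀ (δ : ℚ) → 0ℚ < δ → ∀ N k → k ℕ.≤ floorScaled δ N → ι k ≤ δ * ι (2 ^ N)
floorScaled-bound δ@(mkℚ (ℤ.+ p) dm _) δ>0 N k k≤ =
  ℚP.*-cancelʳ-≤-pos (ι d) {{positive (ι-positive {d} (s≤s z≤n))}} (begin
    ι k * ι d                 ≡⟨ sym (ι-* k d) ⟩
    ι (k ℕ.* d)               ≤⟨ ι-mono (ℕP.*-monoˡ-≤ d k≤) ⟩
    ι (floorScaled δ N ℕ.* d) ≤⟨ ι-mono (m/n*n≤m (p ℕ.* 2 ^ N) d) ⟩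
    ι (p ℕ.* 2 ^ N)           ≡⟨ ι-* p (2 ^ N) ⟩
    ι p * Y                   ≡⟨ cong (_* Y) (sym (numerator-product δ δ>0)) ⟩
    (δ * ι d) * Y             ≡⟨ solve 3 (λ x y z → (x :* z) :* y := (x :* y) :* z) refl δ Y (ι d) ⟩
    (δ * Y) * ι d             ∎)
  where
  open ℚP.≤-Reasoning
  d = suc dm
  Y = ι (2 ^ N)
floorScaled-bound (mkℚ ℤ.-[1+ _ ] _ _) (ℚ.*<* ()) N k k≤

half-sum-double : ∀ x y z → ½ * (x + y) * (z + z) ≡ x * z + y * z
half-sum-double x y z = trans
  (solve 4 (λ h x y z → h :* (x :+ y) :* (z :+ z) := (h :+ h) :* (x :* z :+ y :* z)) refl ½ x y z)
  (ℚP.*-identityˡ (x * z + y * z))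

half-double : ∀ a → ½ * (a + a) ≡ a
half-double a = trans (solve 2 (λ h a → h :* (a :+ a) := (h :+ h) :* a) refl ½ a) (ℚP.*-identityˡ a)

Expect-mono : ∀ N {f g : Vec Bool N → ℚ} → (∀ r → f r ≤ g r) → Expect N f ≤ Expect N g
Expect-mono zero    f≤g = f≤g []
Expect-mono (suc N) f≤g = ℚP.*-monoˡ-≤-nonNeg ½
  (ℚP.+-mono-≤ (Expect-mono N (f≤g ∘ (false ∷_))) (Expect-mono N (f≤g ∘ (true ∷_))))

Expect-const : ∀ N a → Expect N (λ _ → a) ≡ a
Expect-const zero    a = refl
Expect-const (suc N) a = trans (cong (λ x → ½ * (x + x)) (Expect-const N a)) (half-double a)

Expect-shift : ∀ N a (f : Vec Bool N → ℚ) → Expect N (λ r → a + f r) ≡ a + Expect N f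
Expect-shift zero    a f = refl
Expect-shift (suc N) a f = begin
  ½ * (Expect N (λ r → a + f (false ∷ r)) + Expect N (λ r → a + f (true ∷ r)))
    ≡⟨ cong₂ (λ u v → ½ * (u + v)) (Expect-shift N a _) (Expect-shift N a _) ⟩
  ½ * ((a + x) + (a + y))
    ≡⟨ solve 4 (λ h a x y → h :* ((a :+ x) :+ (a :+ y)) := h :* (a :+ a) :+ h :* (x :+ y))
               refl ½ a x y ⟩
  ½ * (a + a) + ½ * (x + y)
    ≡⟨ cong (_+ ½ * (x + y)) (half-double a) ⟩
  a + ½ * (x + y) ∎
  where
  open ≡-Reasoning
  x = Expect N (f ∘ (false ∷_))
  y = Expect N (f ∘ (true ∷_))

indicator : Bool → ℚ
indicator true  = 1ℚ
indicator false = 0ℚ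

Expect-indicator : ∀ N (b : Vec Bool N → Bool) →
                   Expect N (indicator ∘ b) * ι (2 ^ N) ≡ ι (length (failures N b))
Expect-indicator zero b with b []
... | true  = refl
... | false = refl
Expect-indicator (suc N) b = begin
  ½ * (E₀ + E₁) * ι (2 ℕ.* 2 ^ N)   ≡⟨ cong (½ * (E₀ + E₁) *_) (ι-double (2 ^ N)) ⟩
  ½ * (E₀ + E₁) * (Y + Y)           ≡⟨ half-sum-double E₀ E₁ Y ⟩
  E₀ * Y + E₁ * Y                   ≡⟨ cong₂ _+_ (Expect-indicator N b₀) (Expect-indicator N b₁) ⟩
  ι (length L₀) + ι (length L₁)     ≡⟨ sym (ι-+ (length L₀) (length L₁)) ⟩
  ι (length L₀ ℕ.+ length L₁)       ≡⟨ cong ι (sym length-failures) ⟩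
  ι (length (failures (suc N) b))   ∎
  where
  open ≡-Reasoning
  b₀ b₁ : Vec Bool N → Bool
  b₀ = b ∘ (false ∷_)
  b₁ = b ∘ (true ∷_)
  E₀ = Expect N (indicator ∘ b₀)
  E₁ = Expect N (indicator ∘ b₁)
  Y  = ι (2 ^ N)
  L₀ = failures N b₀
  L₁ = failures N b₁
  length-failures : length (failures (suc N) b) ≡ length L₀ ℕ.+ length L₁
  length-failures = trans (length-++ (map (false ∷_) L₀))
                          (cong₂ ℕ._+_ (length-map (false ∷_) L₀) (length-map (true ∷_) L₁))

Expect-indicator-bound : ∀ N (δ : ℚ) → 0ℚ < δ → (b : Vec Bool N → Bool) →
                         length (failures N b) ℕ.≤ floorScaled δ N →
                         Expect N (indicator ∘ b) ≤ δ
Expect-indicator-bound N δ δ>0 b few =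
  ℚP.*-cancelʳ-≤-pos (ι (2 ^ N)) {{positive (ι-positive (ℕP.m^n>0 2 N))}}
    (subst (_≤ δ * ι (2 ^ N)) (sym (Expect-indicator N b))
      (floorScaled-bound δ δ>0 N (length (failures N b)) few))

¬¬-decidable : ∀ N (P : Vec Bool N → Set) → ¬ ¬ (∀ r → Dec (P r))
¬¬-decidable zero    P k = ¬¬-excluded-middle λ d → k λ { [] → d }
¬¬-decidable (suc N) P k =
  ¬¬-decidable N (P ∘ (false ∷_)) λ d₀ →
  ¬¬-decidable N (P ∘ (true ∷_))  λ d₁ →
  k λ { (false ∷ r) → d₀ r ; (true ∷ r) → d₁ r }

randomized-step-bound : ∀ N (f : Vec Bool N → ℚ) (b : Vec Bool N → Bool) c′ δ →
                        0ℚ < δ → 0ℚ ≤ c′ → (∀ r → f r ≤ 1ℚ) → (∀ r → b r ≡ false → f r ≤ c′) →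
                        length (failures N b) ℕ.≤ floorScaled δ N → Expect N f ≤ c′ + δ
randomized-step-bound N f b c′ δ δ>0 c′≥0 f≤1 unflagged few = begin
  Expect N f                               ≤⟨ Expect-mono N pointwise ⟩
  Expect N (λ r → c′ + indicator (b r))    ≡⟨ Expect-shift N c′ (indicator ∘ b) ⟩
  c′ + Expect N (indicator ∘ b)            ≤⟨ ℚP.+-monoʳ-≤ c′ (Expect-indicator-bound N δ δ>0 b few) ⟩
  c′ + δ                                   ∎
  where
  open ℚP.≤-Reasoning
  pointwise : ∀ r → f r ≤ c′ + indicator (b r)
  pointwise r with b r in flag
  ... | false = subst (f r ≤_) (sym (ℚP.+-identityʳ c′)) (unflagged r flag)
  ... | true  = ℚP.≤-trans (f≤1 r) (ℚP.+-monoˡ-≤ 1ℚ c′≥0)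

remaining-nonneg : ∀ {c δ} → δ ≤ c → 0ℚ ≤ c - δ
remaining-nonneg {c} {δ} δ≤c = subst (_≤ c - δ) (ℚP.+-inverseʳ δ) (ℚP.+-monoˡ-≤ (- δ) δ≤c)

remaining+spent : ∀ c δ → (c - δ) + δ ≡ c
remaining+spent = solve 2 (λ c δ → (c :- δ) :+ δ := c) refl

AllTrue-∷ : ∀ {A Γ} → TrueInℕ A → AllTrue Γ → AllTrue (A ∷ Γ)
AllTrue-∷ a T (here refl) = a
AllTrue-∷ a T (there A∈Γ) = T A∈Γ

module _ (F : Sentence) where

  ProbAchieve-≤1 : ∀ {Γ c} (π : Strategy Γ c) → ProbAchieve F π ≤ 1ℚ
  ProbAchieve-≤1 {Γ} stop with member? _≟F_ F Γ
  ... | yes _ = ℚP.≤-refl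
  ... | no  _ = ℚP.<⇒≤ (ℚP.positive⁻¹ 1ℚ)
  ProbAchieve-≤1 (step φ _ π) = ProbAchieve-≤1 π
  ProbAchieve-≤1 (toss N δ R _ _ _ k) = ℚP.≤-trans
    (Expect-mono N (ProbAchieve-≤1 ∘ k)) (ℚP.≤-reflexive (Expect-const N 1ℚ))

  -- Ordinary steps accept only true statements (soundness); a randomized step
  -- costing δ accepts a false axiom with probability ≤ δ, by the true counting
  -- statement, and otherwise continues with capital c - δ.
  capital-bound : ¬ TrueInℕ F → ∀ {Γ c} (π : Strategy Γ c) → AllTrue Γ → 0ℚ ≤ c →
                  ProbAchieve F π ≤ c
  capital-bound ¬F {Γ} stop T c≥0 with member? _≟F_ F Γ
  ... | yes F∈Γ = ⊥-elim (¬F (T F∈Γ))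
  ... | no  _   = c≥0
  capital-bound ¬F (step φ ⊢φ π) T c≥0 =
    capital-bound ¬F π (AllTrue-∷ (sound ⊢φ T (λ ())) T) c≥0
  capital-bound ¬F {c = c} (toss N δ R δ>0 δ≤c count∈Γ k) T _ =
    -- The claim is a decidable inequality, so R(r) may be assumed decided for all r.
    decidable-stable (_ ℚP.≤? c) λ ¬bound → ¬¬-decidable N R-holds (¬bound ∘ bound)
    where
    R-holds : Vec Bool N → Set
    R-holds r = TrueInℕ (R [ num (code r) ])
    unflagged : (decide : ∀ r → Dec (R-holds r)) → ∀ r → isNo (decide r) ≡ false →
                ProbAchieve F (k r) ≤ c - δ
    unflagged decide r _ with decide r
    ... | yes Rr = capital-bound ¬F (k r) (AllTrue-∷ Rr T) (remaining-nonneg δ≤c)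
    flagged : (decide : ∀ r → Dec (R-holds r)) → ∀ r → isNo (decide r) ≡ true → ¬ R-holds r
    flagged decide r _ with decide r
    ... | no ¬Rr = ¬Rr
    bound : (∀ r → Dec (R-holds r)) → Expect N (ProbAchieve F ∘ k) ≤ c
    bound decide = begin
      Expect N (ProbAchieve F ∘ k)
        ≤⟨ randomized-step-bound N (ProbAchieve F ∘ k) (isNo ∘ decide) (c - δ) δ δ>0
             (remaining-nonneg δ≤c) (ProbAchieve-≤1 ∘ k) (unflagged decide)
             (failures-bound N _ R (T count∈Γ) (isNo ∘ decide) (flagged decide)) ⟩
      (c - δ) + δ
        ≡⟨ remaining+spent c δ ⟩
      c ∎
      where open ℚP.≤-Reasoning

proposition1 : (ε : ℚ) → 0ℚ < ε → (F : Sentence) → (π : Strategy [] ε) →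
               ε < ProbAchieve F π → TrueInℕ F
proposition1 ε ε>0 F π ε<P = Sat-stable (λ ()) F λ ¬F →
  ℚP.<-irrefl refl (ℚP.<-≤-trans ε<P (capital-bound F ¬F π (λ ()) (ℚP.<⇒≤ ε>0)))
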